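{- Let $S$ be an HL semigroup and let $u\in 0^+(S)$. Then $D(u\otimes u)\in 0^+(S)$.
   Context: A dense subsemigroup $S$ of $((0,\infty),+)$ is called an HL semigroup if $S\cap(0,1)$ is a subsemigroup of $((0,1),\cdot)$ and for each $y\in S\cap(0,1)$ and each $x\in S$, both $x/y\in S$ and $yx\in S$. $\beta S$ denotes the set of ultrafilters on the discrete set $S$, and $0^+(S)=\{p\in\beta S: S\cap(0,\epsilon)\in p \text{ for all } \epsilon>0\}$. For $p,q\in\beta S$, the tensor product is the ultrafilter on $S\times S$ given by $p\otimes q=\{A\subseteq S\times S: \{x\in S: \{y\in S:(x,y)\in A\}\in q\}\in p\}$. Fix $s_0\in S$ and define $D:S\times S\to S$ by $D(x,y)=y/x$ if $x\in S\cap(0,1)$ and $D(x,y)=s_0$ otherwise. For an ultrafilter $w$ on $S\times S$, $D(w)$ denotes the image ultrafilter $\{B\subseteq S: D^{ -1}[B]\in w\}$ on $S$. -}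

module Defs where

open import Level using (Level; suc; zero)
open import Data.Product using (Σ; _×_; _,_; ∃)
open import Data.Sum using (_⊎_)
open import Data.Unit using (⊤)
open import Data.Empty using (⊥)
open import Relation.Nullary using (¬_)
open import Relation.Binary.PropositionalEquality using (_≡_)

-- The real numbers, given abstractly as a Dedekind-complete ordered field
-- (unique up to isomorphism). Inverse is total (value at 0 irrelevant).
record RealField : Set₁ where
  infixl 6 _+_
  infixl 7 _*_
  infix 4 _<_
  field
    ℝ     : Set
    0ℝ 1ℝ : ℝ
    _+_ _*_ : ℝ → ℝ → ℝ
    -_    : ℝ → ℝ
    _⁻¹   : ℝ → ℝ
    _<_   : ℝ → ℝ → Set
    +-assoc : ∀ x y z → (x + y) + z ≡ x + (y + z)
    +-comm  : ∀ x y → x + y ≡ y + x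
    +-idʳ   : ∀ x → x + 0ℝ ≡ x
    +-invʳ  : ∀ x → x + (- x) ≡ 0ℝ
    *-assoc : ∀ x y z → (x * y) * z ≡ x * (y * z)
    *-comm  : ∀ x y → x * y ≡ y * x
    *-idʳ   : ∀ x → x * 1ℝ ≡ x
    *-invʳ  : ∀ x → ¬ (x ≡ 0ℝ) → x * (x ⁻¹) ≡ 1ℝ
    distribˡ : ∀ x y z → x * (y + z) ≡ (x * y) + (x * z)
    0≢1     : ¬ (0ℝ ≡ 1ℝ)
    <-irrefl : ∀ x → ¬ (x < x)
    <-trans  : ∀ {x y z} → x < y → y < z → x < z
    <-tri    : ∀ x y → x < y ⊎ (x ≡ y ⊎ y < x)
    +-mono-< : ∀ {x y} z → x < y → x + z < y + z
    *-pos    : ∀ {x y} → 0ℝ < x → 0ℝ < y → 0ℝ < x * y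
    complete : (P : ℝ → Set) → (∃ λ x → P x) → (∃ λ b → ∀ x → P x → ¬ (b < x)) →
               ∃ λ s → (∀ x → P x → ¬ (s < x)) × (∀ b → (∀ x → P x → ¬ (b < x)) → ¬ (b < s))

module _ (R : RealField) where
  open RealField R

  _/_ : ℝ → ℝ → ℝ
  y / x = y * (x ⁻¹)

  -- S ⊆ ℝ given as a (proof-irrelevant) predicate; HL semigroup conditions.
  record IsHL (S : ℝ → Set) : Set where
    field
      S-prop : ∀ {x} (p q : S x) → p ≡ q
      S-pos  : ∀ {x} → S x → 0ℝ < x
      S-+    : ∀ {x y} → S x → S y → S (x + y)
      S-dense : ∀ a b → 0ℝ < a → a < b → ∃ λ x → S x × (a < x × x < b)
      S-*    : ∀ {x y} → S x → x < 1ℝ → S y → y < 1ℝ → S (x * y)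
      S-div  : ∀ {x y} → S y → y < 1ℝ → S x → S (x / y)
      S-mul  : ∀ {x y} → S y → y < 1ℝ → S x → S (y * x)

  El : (S : ℝ → Set) → Set
  El S = Σ ℝ S

  val : {S : ℝ → Set} → El S → ℝ
  val (x , _) = x

  record IsUltrafilter (S : ℝ → Set) (mem : (El S → Set) → Set) : Set₁ where
    field
      upward : ∀ (A B : El S → Set) → (∀ a → A a → B a) → mem A → mem B
      inter  : ∀ (A B : El S → Set) → mem A → mem B → mem (λ a → A a × B a)
      full   : mem (λ _ → ⊤)
      proper : ¬ mem (λ _ → ⊥)
      ultra  : ∀ (A : El S → Set) → mem A ⊎ mem (λ a → ¬ A a)

  In0⁺ : (S : ℝ → Set) → ((El S → Set) → Set) → Set₁
  In0⁺ S mem = IsUltrafilter S mem ×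
               (∀ ε → 0ℝ < ε → mem (λ a → val a < ε))

  _⊗_ : {S : ℝ → Set} → ((El S → Set) → Set) → ((El S → Set) → Set) →
        (El S → El S → Set) → Set
  (p ⊗ q) A = p (λ a → q (λ b → A a b))

  module _ (S : ℝ → Set) (hl : IsHL S) (s₀ : El S) where
    open IsHL hl

    -- preimage D⁻¹[B] ⊆ S × S, where D(x,y) = y/x if x ∈ S ∩ (0,1), s₀ otherwise
    D⁻¹ : (El S → Set) → El S → El S → Set
    D⁻¹ B (x , sx) (y , sy) =
      Σ (x < 1ℝ) (λ h → B (y / x , S-div sx h sy)) ⊎ ((¬ (x < 1ℝ)) × B s₀)

    Dimg : ((El S → El S → Set) → Set) → (El S → Set) → Set
    Dimg w B = w (D⁻¹ B)

-- Every property of an ultrafilter passes to the image of an ultrafilter on S × S, and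
-- u ⊗ u is an ultrafilter, so D(u ⊗ u) is one.  It lies in 0⁺(S) because, given ε > 0,
-- u-almost every x lies in (0,1), and for each such x the set of y < εx, on which
-- D(x,y) = y/x < ε, belongs to u.
module Submission where

open import Defs
open import Data.Product using (_×_; _,_; proj₁; proj₂)
open import Data.Sum using (_⊎_; inj₁; inj₂; map₂)
open import Data.Unit using (⊤; tt)
open import Data.Empty using (⊥; ⊥-elim)
open import Relation.Nullary using (¬_)
open import Relation.Binary.PropositionalEquality
  using (_≡_; refl; sym; trans; cong; cong₂; subst)

module OrderedFieldProperties (R : RealField) where
  open RealField R
  open Relation.Binary.PropositionalEquality.≡-Reasoning

  <-respˡ-≡ : ∀ {x y z} → x ≡ y → x < z → y < z
  <-respˡ-≡ refl x<z = x<z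

  <-respʳ-≡ : ∀ {x y z} → y ≡ z → x < y → x < z
  <-respʳ-≡ refl x<y = x<y

  <-asym : ∀ {x y} → x < y → ¬ (y < x)
  <-asym x<y y<x = <-irrefl _ (<-trans x<y y<x)

  <-or-≮ : ∀ x y → x < y ⊎ ¬ (x < y)
  <-or-≮ x y with <-tri x y
  ... | inj₁ x<y         = inj₁ x<y
  ... | inj₂ (inj₁ refl) = inj₂ (<-irrefl x)
  ... | inj₂ (inj₂ y<x)  = inj₂ (<-asym y<x)

  *-zeroʳ : ∀ x → x * 0ℝ ≡ 0ℝ
  *-zeroʳ x = begin
    x * 0ℝ                               ≡⟨ sym (+-idʳ _) ⟩
    x * 0ℝ + 0ℝ                          ≡⟨ cong (x * 0ℝ +_) (sym (+-invʳ (x * 0ℝ))) ⟩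
    x * 0ℝ + (x * 0ℝ + - (x * 0ℝ))       ≡⟨ sym (+-assoc _ _ _) ⟩
    (x * 0ℝ + x * 0ℝ) + - (x * 0ℝ)       ≡⟨ cong (_+ - (x * 0ℝ)) (sym (distribˡ x 0ℝ 0ℝ)) ⟩
    x * (0ℝ + 0ℝ) + - (x * 0ℝ)           ≡⟨ cong (λ z → x * z + - (x * 0ℝ)) (+-idʳ 0ℝ) ⟩
    x * 0ℝ + - (x * 0ℝ)                  ≡⟨ +-invʳ _ ⟩
    0ℝ                                   ∎

  *-distribʳ-difference : ∀ x y z → (x + - y) * z + y * z ≡ x * z
  *-distribʳ-difference x y z = begin
    (x + - y) * z + y * z          ≡⟨ cong₂ _+_ (*-comm _ _) (*-comm _ _) ⟩
    z * (x + - y) + z * y          ≡⟨ cong (_+ z * y) (distribˡ z x (- y)) ⟩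
    (z * x + z * - y) + z * y      ≡⟨ +-assoc _ _ _ ⟩
    z * x + (z * - y + z * y)      ≡⟨ cong (z * x +_) (sym (distribˡ z (- y) y)) ⟩
    z * x + z * (- y + y)          ≡⟨ cong (λ w → z * x + z * w) (trans (+-comm _ _) (+-invʳ y)) ⟩
    z * x + z * 0ℝ                 ≡⟨ cong (z * x +_) (*-zeroʳ z) ⟩
    z * x + 0ℝ                     ≡⟨ +-idʳ _ ⟩
    z * x                          ≡⟨ *-comm _ _ ⟩
    x * z                          ∎

  *-monoˡ-< : ∀ {x y z} → 0ℝ < z → x < y → x * z < y * z
  *-monoˡ-< {x} {y} {z} 0<z x<y =
    <-respˡ-≡ 0+xz≡xz (<-respʳ-≡ (*-distribʳ-difference y x z) (+-mono-< (x * z) (*-pos 0<y-x 0<z)))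
    where
    0<y-x : 0ℝ < y + - x
    0<y-x = <-respˡ-≡ (+-invʳ x) (+-mono-< (- x) x<y)
    0+xz≡xz : 0ℝ + x * z ≡ x * z
    0+xz≡xz = trans (+-comm _ _) (+-idʳ _)

  0<1 : ∀ {x} → 0ℝ < x → 0ℝ < 1ℝ
  0<1 {x} 0<x with <-tri 0ℝ 1ℝ
  ... | inj₁ 0<1        = 0<1
  ... | inj₂ (inj₁ 0≡1) = ⊥-elim (0≢1 0≡1)
  ... | inj₂ (inj₂ 1<0) = ⊥-elim (<-asym 0<x x<0)
    where
    x<0 : x < 0ℝ
    x<0 = <-respˡ-≡ (trans (*-comm _ _) (*-idʳ x))
            (<-respʳ-≡ (trans (*-comm _ _) (*-zeroʳ x)) (*-monoˡ-< 0<x 1<0))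

  *⁻¹-cancelʳ : ∀ {x} y → 0ℝ < x → (y * x ⁻¹) * x ≡ y
  *⁻¹-cancelʳ {x} y 0<x = begin
    (y * x ⁻¹) * x   ≡⟨ *-assoc _ _ _ ⟩
    y * (x ⁻¹ * x)   ≡⟨ cong (y *_) (trans (*-comm _ _) (*-invʳ x x≢0)) ⟩
    y * 1ℝ           ≡⟨ *-idʳ y ⟩
    y                ∎
    where
    x≢0 : ¬ (x ≡ 0ℝ)
    x≢0 x≡0 = <-irrefl 0ℝ (<-respʳ-≡ x≡0 0<x)

  <-*⇒*⁻¹-< : ∀ {x y ε} → 0ℝ < x → y < ε * x → y * x ⁻¹ < ε
  <-*⇒*⁻¹-< {x} {y} {ε} 0<x y<εx with <-tri (y * x ⁻¹) ε
  ... | inj₁ y/x<ε         = y/x<ε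
  ... | inj₂ (inj₁ refl)   = ⊥-elim (<-irrefl y (<-respʳ-≡ (*⁻¹-cancelʳ y 0<x) y<εx))
  ... | inj₂ (inj₂ ε<y/x)  =
    ⊥-elim (<-asym y<εx (<-respʳ-≡ (*⁻¹-cancelʳ y 0<x) (*-monoˡ-< 0<x ε<y/x)))

module _ (R : RealField) (S : RealField.ℝ R → Set) where
  record IsUltrafilter² (w : (El R S → El R S → Set) → Set) : Set₁ where
    field
      upward : ∀ (A B : El R S → El R S → Set) → (∀ a b → A a b → B a b) → w A → w B
      inter  : ∀ (A B : El R S → El R S → Set) → w A → w B → w (λ a b → A a b × B a b)
      full   : w (λ _ _ → ⊤)
      proper : ¬ w (λ _ _ → ⊥)
      ultra  : ∀ (A : El R S → El R S → Set) → w A ⊎ w (λ a b → ¬ A a b)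

  ⊗-isUltrafilter² : ∀ {p q} → IsUltrafilter R S p → IsUltrafilter R S q →
                     IsUltrafilter² (_⊗_ R {S} p q)
  ⊗-isUltrafilter² {p} {q} hp hq = record
    { upward = λ A B A⊆B → P.upward _ _ (λ a → Q.upward _ _ (A⊆B a))
    ; inter  = λ A B pA pB → P.upward _ _ (λ a qAB → Q.inter _ _ (proj₁ qAB) (proj₂ qAB))
                                       (P.inter _ _ pA pB)
    ; full   = P.upward _ _ (λ _ _ → Q.full) P.full
    ; proper = λ p⊥ → P.proper (P.upward _ _ (λ _ q⊥ → Q.proper q⊥) p⊥)
    ; ultra  = ultra
    }
    where
    module P = IsUltrafilter hp
    module Q = IsUltrafilter hq
    ultra : ∀ A → (_⊗_ R {S} p q) A ⊎ (_⊗_ R {S} p q) (λ a b → ¬ A a b)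
    ultra A with P.ultra (λ a → q (A a))
    ... | inj₁ pA  = inj₁ pA
    ... | inj₂ p¬A = inj₂ (P.upward _ _ complement p¬A)
      where
      complement : ∀ a → ¬ q (A a) → q (λ b → ¬ A a b)
      complement a ¬qA with Q.ultra (A a)
      ... | inj₁ qA  = ⊥-elim (¬qA qA)
      ... | inj₂ q¬A = q¬A

  module _ (hl : IsHL R S) (s₀ : El R S) where
    open RealField R
    open IsHL hl
    open OrderedFieldProperties R

    D⁻¹-mono : ∀ (A B : El R S → Set) → (∀ c → A c → B c) →
               ∀ a b → D⁻¹ R S hl s₀ A a b → D⁻¹ R S hl s₀ B a b
    D⁻¹-mono A B A⊆B _ _ (inj₁ (x<1 , A[y/x])) = inj₁ (x<1 , A⊆B _ A[y/x])
    D⁻¹-mono A B A⊆B _ _ (inj₂ (x≮1 , A[s₀]))  = inj₂ (x≮1 , A⊆B _ A[s₀])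

    -- The witnesses of y / x ∈ S in the two preimages are identified by S-prop.
    D⁻¹-× : ∀ (A B : El R S → Set) a b → D⁻¹ R S hl s₀ A a b → D⁻¹ R S hl s₀ B a b →
            D⁻¹ R S hl s₀ (λ c → A c × B c) a b
    D⁻¹-× A B (x , _) (y , _) (inj₁ (x<1 , A[y/x])) (inj₁ (_ , B[y/x])) =
      inj₁ (x<1 , A[y/x] , subst (λ s → B (y * x ⁻¹ , s)) (S-prop _ _) B[y/x])
    D⁻¹-× A B _ _ (inj₁ (x<1 , _)) (inj₂ (x≮1 , _)) = ⊥-elim (x≮1 x<1)
    D⁻¹-× A B _ _ (inj₂ (x≮1 , _)) (inj₁ (x<1 , _)) = ⊥-elim (x≮1 x<1)
    D⁻¹-× A B _ _ (inj₂ (x≮1 , A[s₀])) (inj₂ (_ , B[s₀])) = inj₂ (x≮1 , A[s₀] , B[s₀])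

    D⁻¹-⊤ : ∀ a b → D⁻¹ R S hl s₀ (λ _ → ⊤) a b
    D⁻¹-⊤ (x , _) _ with <-or-≮ x 1ℝ
    ... | inj₁ x<1 = inj₁ (x<1 , tt)
    ... | inj₂ x≮1 = inj₂ (x≮1 , tt)

    D⁻¹-⊥ : ∀ a b → ¬ D⁻¹ R S hl s₀ (λ _ → ⊥) a b
    D⁻¹-⊥ _ _ (inj₁ (_ , ()))
    D⁻¹-⊥ _ _ (inj₂ (_ , ()))

    D⁻¹-¬ : ∀ (A : El R S → Set) a b → ¬ D⁻¹ R S hl s₀ A a b →
            D⁻¹ R S hl s₀ (λ c → ¬ A c) a b
    D⁻¹-¬ A (x , _) _ ¬D⁻¹A with <-or-≮ x 1ℝ
    ... | inj₁ x<1 = inj₁ (x<1 , λ A[y/x] → ¬D⁻¹A (inj₁ (x<1 , A[y/x])))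
    ... | inj₂ x≮1 = inj₂ (x≮1 , λ A[s₀] → ¬D⁻¹A (inj₂ (x≮1 , A[s₀])))

    Dimg-isUltrafilter : ∀ {w} → IsUltrafilter² w → IsUltrafilter R S (Dimg R S hl s₀ w)
    Dimg-isUltrafilter {w} hw = record
      { upward = λ A B A⊆B → W.upward _ _ (D⁻¹-mono A B A⊆B)
      ; inter  = λ A B wA wB → W.upward _ _ (λ a b AB → D⁻¹-× A B a b (proj₁ AB) (proj₂ AB))
                                          (W.inter _ _ wA wB)
      ; full   = W.upward _ _ (λ a b _ → D⁻¹-⊤ a b) W.full
      ; proper = λ w⊥ → W.proper (W.upward _ _ D⁻¹-⊥ w⊥)
      ; ultra  = λ A → map₂ (W.upward _ _ (D⁻¹-¬ A)) (W.ultra (D⁻¹ R S hl s₀ A))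
      }
      where module W = IsUltrafilter² hw

    Dimg-⊗-small : ∀ {p q} → In0⁺ R S p → In0⁺ R S q →
                   ∀ ε → 0ℝ < ε → Dimg R S hl s₀ (_⊗_ R {S} p q) (λ c → val R c < ε)
    Dimg-⊗-small {p} {q} (hp , p-small) (hq , q-small) ε 0<ε =
      IsUltrafilter.upward hp _ _ small-quotients (p-small 1ℝ (0<1 0<ε))
      where
      small-quotients : ∀ a → val R a < 1ℝ → q (D⁻¹ R S hl s₀ (λ c → val R c < ε) a)
      small-quotients (x , sx) x<1 =
        IsUltrafilter.upward hq _ _ (λ _ y<εx → inj₁ (x<1 , <-*⇒*⁻¹-< 0<x y<εx))
          (q-small (ε * x) (*-pos 0<ε 0<x))
        where
        0<x : 0ℝ < x
        0<x = S-pos sx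

lemma4p3 : (R : RealField) (S : RealField.ℝ R → Set) (hl : IsHL R S) (s₀ : El R S)
           (u : (El R S → Set) → Set) →
           In0⁺ R S u → In0⁺ R S (Dimg R S hl s₀ (_⊗_ R {S} u u))
lemma4p3 R S hl s₀ u u∈0⁺ =
  Dimg-isUltrafilter R S hl s₀ (⊗-isUltrafilter² R S (proj₁ u∈0⁺) (proj₁ u∈0⁺)) ,
  Dimg-⊗-small R S hl s₀ u∈0⁺ u∈0⁺
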